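{- Let $\rho>0$ and $r>0$ be real numbers and $k$ a positive integer. Let $G$ be a $(\rho,r)$-sparse graph with average degree at least $4\rho(k+2)$. Then $G$ contains (as a subgraph) every tree with at most $\frac{r}{2(k+2)}$ vertices and maximum degree at most $k$.
   Context: A graph $G$ is $(\rho,r)$-sparse if for every $R\subset V(G)$ with $|R|\leq r$, the number of edges of the induced subgraph $G[R]$ is at most $\rho|R|$.
   Formalization: The parameters ρ and r range over the positive rationals instead of the positive reals. -}

module Defs where

open import Data.Nat using (ℕ; zero; suc; _+_; _*_; _<ᵇ_; NonZero)
open import Data.Fin using (Fin; toℕ) renaming (zero to fzero; suc to fsuc)
open import Data.Bool using (Bool; true; false; if_then_else_; _∧_)
open import Data.List using (List; []; _∷_; length)
open import Data.List.Relation.Unary.Unique.Propositional using (Unique)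
open import Data.Product using (Σ; _×_; _,_; ∃-syntax)
open import Data.Integer using (+_)
open import Data.Rational using (ℚ; _/_; _≤_; 0ℚ; _<_) renaming (_*_ to _·_)
open import Relation.Binary.PropositionalEquality using (_≡_)
open import Relation.Nullary using (¬_)
open import Function.Definitions using (Injective)

record Graph (n : ℕ) : Set where
  field
    adj    : Fin n → Fin n → Bool
    sym    : ∀ u v → adj u v ≡ adj v u
    irrefl : ∀ v → adj v v ≡ false
open Graph public

⟦_⟧ : ℕ → ℚ
⟦ m ⟧ = + m / 1

count : ∀ {n} → (Fin n → Bool) → ℕ
count {zero}  p = 0
count {suc n} p = (if p fzero then 1 else 0) + count (λ i → p (fsuc i))

sumFin : ∀ {n} → (Fin n → ℕ) → ℕ
sumFin {zero}  f = 0
sumFin {suc n} f = f fzero + sumFin (λ i → f (fsuc i))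

Subset : ℕ → Set
Subset n = Fin n → Bool

∣_∣ : ∀ {n} → Subset n → ℕ
∣ R ∣ = count R

edgesIn : ∀ {n} → Graph n → Subset n → ℕ
edgesIn G R = sumFin (λ i → count (λ j → R i ∧ R j ∧ adj G i j ∧ (toℕ i <ᵇ toℕ j)))

edges : ∀ {n} → Graph n → ℕ
edges G = edgesIn G (λ _ → true)

degree : ∀ {n} → Graph n → Fin n → ℕ
degree G v = count (adj G v)

averageDegree : ∀ {n} .{{_ : NonZero n}} → Graph n → ℚ
averageDegree {n} G = + (2 * edges G) / n

Sparse : ∀ {n} → ℚ → ℚ → Graph n → Set
Sparse ρ r G = ∀ (R : Subset _) → ⟦ ∣ R ∣ ⟧ ≤ r → ⟦ edgesIn G R ⟧ ≤ ρ · ⟦ ∣ R ∣ ⟧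

MaxDegreeAtMost : ∀ {n} → Graph n → ℕ → Set
MaxDegreeAtMost G k = ∀ v → degree G v Data.Nat.≤ k

data Walk {n} (G : Graph n) : Fin n → Fin n → Set where
  here  : ∀ {v} → Walk G v v
  step  : ∀ {u w v} → adj G u w ≡ true → Walk G w v → Walk G u v

Connected : ∀ {n} → Graph n → Set
Connected G = ∀ u v → Walk G u v

PathAdj : ∀ {n} → Graph n → Fin n → List (Fin n) → Fin n → Set
PathAdj G u []       v = adj G u v ≡ true
PathAdj G u (w ∷ ws) v = (adj G u w ≡ true) × PathAdj G w ws v

-- a cycle: distinct vertices v₀ v₁ … v_{ℓ-1}, ℓ ≥ 3, consecutive ones adjacent
-- and v_{ℓ-1} adjacent to v₀.  Encoded as v₀ ∷ vs with v₀ … last adjacency back to v₀.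
record Cycle {n} (G : Graph n) : Set where
  field
    start    : Fin n
    rest     : List (Fin n)
    long     : 2 Data.Nat.≤ length rest
    distinct : Unique (start ∷ rest)
    closed   : PathAdj G start rest start

Acyclic : ∀ {n} → Graph n → Set
Acyclic G = ¬ Cycle G

IsTree : ∀ {m} → Graph m → Set
IsTree {m} T = NonZero m × Connected T × Acyclic T

_⊆G_ : ∀ {m n} → Graph m → Graph n → Set
_⊆G_ {m} {n} T G = Σ (Fin m → Fin n) λ f →
  Injective _≡_ _≡_ f × (∀ u v → adj T u v ≡ true → adj G (f u) (f v) ≡ true)

{-# OPTIONS --safe #-}
-- A vertex set R maximising 2e(R) − λ|R|, for λ slightly below 4ρ(k + 2), spans a
-- nonempty subgraph H of minimum degree at least 2ρ(k + 2).  Sparsity makes H expand: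
-- for X ⊆ H with |X| ≤ 2m the set U = X ∪ Γ_H(X) has |U| ≥ (k + 2)|X|, for otherwise
-- U would have at most r vertices but at least ρ(k + 2)|X| > ρ|U| edges.  A tree with
-- m vertices and maximum degree k then embeds greedily, as in Friedman and Pippenger:
-- grow the image one vertex at a time while every X ⊆ H with |X| ≤ 2m keeps at least
-- Σ_{x ∈ X} c(x) neighbours outside the image, c(x) being the number of tree edges at x
-- still to be embedded.  A new vertex z next to the parent's image v preserves this as
-- long as z avoids Γ(X) for every tight ("critical") X ∌ v.  Critical sets are closed
-- under union by submodularity, and the invariant applied to the largest one together
-- with v provides such a z.
module Submission where

open import Data.Nat
open import Data.Nat.Properties
open import Data.Bool using (Bool; true; false; if_then_else_; _∧_; _∨_; not)
open import Data.Bool.Properties using (∧-zeroʳ; ∧-identityʳ) renaming (_≟_ to _≟ᵇ_)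
open import Data.Fin using (Fin; zero; suc; toℕ; fromℕ<)
open import Data.Fin.Properties using (any?; all?; toℕ-injective; nonZeroIndex)
  renaming (_≟_ to _≟ᶠ_; suc-injective to sucᶠ-injective)
open import Data.Vec.Functional using (updateAt)
open import Data.Vec.Functional.Properties using (updateAt-updates; updateAt-minimal)
open import Data.List using (List; []; _∷_)
open import Data.List.Relation.Unary.All as All using (All; []; _∷_)
open import Data.List.Relation.Unary.All.Properties using (¬Any⇒All¬)
import Data.List.Relation.Unary.Any as Any
open import Data.List.Relation.Unary.AllPairs using ([]; _∷_)
open import Data.List.Relation.Unary.Unique.Propositional using (Unique)
open import Data.List.Membership.Propositional using (_∈_)
open import Data.Product using (Σ-syntax; ∃-syntax; _×_; _,_; proj₁; proj₂)
open import Data.Sum using (_⊎_; inj₁; inj₂; [_,_]′)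
open import Data.Empty using (⊥-elim)
open import Function using (_∘_; const; id)
open import Relation.Nullary using (Dec; yes; no; does)
open import Relation.Nullary.Decidable using (dec-true; _×-dec_; _→-dec_)
open import Relation.Binary.PropositionalEquality
open import Data.Nat.Tactic.RingSolver using (solve-∀)
open import Algebra.Properties.Semiring.Sum +-*-semiring
  using (sum; sum-cong-≗; sum-replicate-zero; ∑-distrib-+; ∑-comm; *-distribˡ-sum)
import Data.Integer as ℤ
import Data.Integer.Properties as ℤ
open import Data.Rational as ℚ using (ℚ; mkℚ; 0ℚ; toℚᵘ) renaming (_*_ to _·_)
import Data.Rational.Properties as ℚ
open import Data.Rational.Unnormalised as ℚᵘ using (mkℚᵘ)
import Data.Rational.Unnormalised.Properties as ℚᵘ
open import Defs renaming (sym to adj-sym)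

variable
  n : ℕ

χ : Bool → ℕ
χ b = if b then 1 else 0

∧-true : ∀ {a b} → a ∧ b ≡ true → a ≡ true × b ≡ true
∧-true {true} b≡true = refl , b≡true

∨-true : ∀ {a b} → a ∨ b ≡ true → a ≡ true ⊎ b ≡ true
∨-true {true}  _ = inj₁ refl
∨-true {false} b≡true = inj₂ b≡true

∨-introˡ : ∀ {a} b → a ≡ true → a ∨ b ≡ true
∨-introˡ b refl = refl

∨-introʳ : ∀ a {b} → b ≡ true → a ∨ b ≡ true
∨-introʳ true  _      = refl
∨-introʳ false b≡true = b≡true

not-true : ∀ {b} → not b ≡ true → b ≡ false
not-true {false} _ = refl

true≢false : ∀ {b} → b ≡ true → b ≢ false
true≢false refl ()

true⇔true⇒≡ : ∀ {a b} → (a ≡ true → b ≡ true) → (b ≡ true → a ≡ true) → a ≡ b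
true⇔true⇒≡ {true}  a⇒b _   = sym (a⇒b refl)
true⇔true⇒≡ {false} {true}  _ b⇒a = b⇒a refl
true⇔true⇒≡ {false} {false} _ _   = refl

sumFin≡sum : (f : Fin n → ℕ) → sumFin f ≡ sum f
sumFin≡sum {zero}  f = refl
sumFin≡sum {suc n} f = cong (f zero +_) (sumFin≡sum (f ∘ suc))

count≡sum : (p : Fin n → Bool) → count p ≡ sum (χ ∘ p)
count≡sum {zero}  p = refl
count≡sum {suc n} p = cong (χ (p zero) +_) (count≡sum (p ∘ suc))

sum-mono-≤ : {f g : Fin n → ℕ} → (∀ i → f i ≤ g i) → sum f ≤ sum g
sum-mono-≤ {zero}  f≤g = z≤n
sum-mono-≤ {suc n} f≤g = +-mono-≤ (f≤g zero) (sum-mono-≤ (f≤g ∘ suc))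

sum-mono-< : {f g : Fin n → ℕ} → (∀ i → f i ≤ g i) → ∀ j → f j < g j → sum f < sum g
sum-mono-< f≤g zero    fj<gj = +-mono-<-≤ fj<gj (sum-mono-≤ (f≤g ∘ suc))
sum-mono-< f≤g (suc j) fj<gj = +-mono-≤-< (f≤g zero) (sum-mono-< (f≤g ∘ suc) j fj<gj)

sum-agree-off : ∀ {f g : Fin n → ℕ} i → (∀ j → j ≢ i → f j ≡ g j) → sum f + g i ≡ sum g + f i
sum-agree-off {suc n} {f} {g} zero f≗g = begin
  f zero + sum (f ∘ suc) + g zero  ≡⟨ cong (λ s → f zero + s + g zero) (sum-cong-≗ (λ j → f≗g (suc j) λ ())) ⟩
  f zero + s + g zero              ≡⟨ swap (f zero) s (g zero) ⟩
  g zero + s + f zero              ∎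
  where
  open ≡-Reasoning
  s : ℕ
  s = sum (g ∘ suc)
  swap : ∀ a s b → a + s + b ≡ b + s + a
  swap = solve-∀
sum-agree-off {suc n} {f} {g} (suc i) f≗g = begin
  f zero + sum (f ∘ suc) + g (suc i)    ≡⟨ +-assoc (f zero) _ _ ⟩
  f zero + (sum (f ∘ suc) + g (suc i))  ≡⟨ cong₂ _+_ (f≗g zero λ ()) (sum-agree-off i f≗g-tail) ⟩
  g zero + (sum (g ∘ suc) + f (suc i))  ≡⟨ +-assoc (g zero) _ _ ⟨
  g zero + sum (g ∘ suc) + f (suc i)    ∎
  where
  open ≡-Reasoning
  f≗g-tail : ∀ j → j ≢ i → f (suc j) ≡ g (suc j)
  f≗g-tail j j≢i = f≗g (suc j) (j≢i ∘ sucᶠ-injective)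

infix  4 _⊆_ _≐_ _⊆?_
infixr 6 _∪_
infixr 7 _∩_
infixl 8 _∖_

_⊆_ : Subset n → Subset n → Set
X ⊆ Y = ∀ i → X i ≡ true → Y i ≡ true

_≐_ : Subset n → Subset n → Set
X ≐ Y = ∀ i → X i ≡ Y i

∅ : Subset n
∅ _ = false

_∪_ _∩_ : Subset n → Subset n → Subset n
(X ∪ Y) i = X i ∨ Y i
(X ∩ Y) i = X i ∧ Y i

_∖_ : Subset n → Subset n → Subset n
(X ∖ Y) i = X i ∧ not (Y i)

_⊆?_ : (X Y : Subset n) → Dec (X ⊆ Y)
X ⊆? Y = all? (λ i → (X i ≟ᵇ true) →-dec (Y i ≟ᵇ true))

⊆-false : ∀ {X Y : Subset n} {i} → X ⊆ Y → Y i ≡ false → X i ≡ false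
⊆-false {X = X} {i = i} X⊆Y Yi with X i in Xi
... | true  = ⊥-elim (true≢false (X⊆Y i Xi) Yi)
... | false = refl

⊆-trans : {X Y Z : Subset n} → X ⊆ Y → Y ⊆ Z → X ⊆ Z
⊆-trans X⊆Y Y⊆Z i = Y⊆Z i ∘ X⊆Y i

∩-⊆ˡ : (X Y : Subset n) → X ∩ Y ⊆ X
∩-⊆ˡ X Y i = proj₁ ∘ ∧-true

∩-⊆ʳ : (X Y : Subset n) → X ∩ Y ⊆ Y
∩-⊆ʳ X Y i = proj₂ ∘ ∧-true {X i}

∩-⊆-intro : {X Y Z : Subset n} → X ⊆ Y → X ⊆ Z → X ⊆ Y ∩ Z
∩-⊆-intro X⊆Y X⊆Z i Xi = cong₂ _∧_ (X⊆Y i Xi) (X⊆Z i Xi)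

∖-mono : {X Y : Subset n} (F : Subset n) → X ⊆ Y → X ∖ F ⊆ Y ∖ F
∖-mono {X = X} F X⊆Y i Xi∖F = let (Xi , Fi) = ∧-true {X i} Xi∖F in cong₂ _∧_ (X⊆Y i Xi) Fi

∖-∪ : (X Y F : Subset n) → (X ∪ Y) ∖ F ⊆ X ∖ F ∪ Y ∖ F
∖-∪ X Y F i X∪Yi∖F with ∧-true {X i ∨ Y i} X∪Yi∖F
... | X∪Yi , Fi with ∨-true {X i} X∪Yi
...   | inj₁ Xi = ∨-introˡ _ (cong₂ _∧_ Xi Fi)
...   | inj₂ Yi = ∨-introʳ _ (cong₂ _∧_ Yi Fi)

∖-∩ : (X Y F : Subset n) → (X ∩ Y) ∖ F ⊆ X ∖ F ∩ Y ∖ F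
∖-∩ X Y F = ∩-⊆-intro (∖-mono F (∩-⊆ˡ X Y)) (∖-mono F (∩-⊆ʳ X Y))

⊆-∖-∪ : (X F : Subset n) → X ⊆ X ∖ F ∪ F
⊆-∖-∪ X F i Xi rewrite Xi with F i
... | true  = refl
... | false = refl

insert : Subset n → Fin n → Subset n
insert X a = updateAt X a (const true)

remove : Subset n → Fin n → Subset n
remove X a = updateAt X a (const false)

∈-insert⁻ : ∀ (X : Subset n) a i → insert X a i ≡ true → i ≡ a ⊎ X i ≡ true
∈-insert⁻ X a i i∈ with i ≟ᶠ a
... | yes i≡a = inj₁ i≡a
... | no  i≢a = inj₂ (trans (sym (updateAt-minimal i a X i≢a)) i∈)

∈-singleton⁻ : ∀ (a i : Fin n) → insert ∅ a i ≡ true → i ≡ a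
∈-singleton⁻ a i i∈ with ∈-insert⁻ ∅ a i i∈
... | inj₁ i≡a = i≡a

⊆-insert : ∀ (X : Subset n) a → X ⊆ insert X a
⊆-insert X a i i∈ with i ≟ᶠ a
... | yes refl = updateAt-updates i X
... | no  i≢a  = trans (updateAt-minimal i a X i≢a) i∈

∖-insert : ∀ (X F : Subset n) a → X ∖ insert F a ≐ remove (X ∖ F) a
∖-insert X F a i with i ≟ᶠ a
... | yes refl
  rewrite updateAt-updates i {const true} F | updateAt-updates i {const false} (X ∖ F) = ∧-zeroʳ (X i)
... | no  i≢a
  rewrite updateAt-minimal i a {const true} F i≢a | updateAt-minimal i a {const false} (X ∖ F) i≢a = refl

count-cong : {p q : Subset n} → p ≐ q → count p ≡ count q
count-cong {p = p} {q} p≐q = begin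
  count p       ≡⟨ count≡sum p ⟩
  sum (χ ∘ p)   ≡⟨ sum-cong-≗ (cong χ ∘ p≐q) ⟩
  sum (χ ∘ q)   ≡⟨ count≡sum q ⟨
  count q       ∎
  where open ≡-Reasoning

count-+ : (p q : Subset n) → count p + count q ≡ sum (λ i → χ (p i) + χ (q i))
count-+ p q = trans (cong₂ _+_ (count≡sum p) (count≡sum q)) (sym (∑-distrib-+ (χ ∘ p) (χ ∘ q)))

χ-mono : ∀ {a b} → (a ≡ true → b ≡ true) → χ a ≤ χ b
χ-mono {false}         _   = z≤n
χ-mono {true}  {true}  _   = ≤-refl
χ-mono {true}  {false} a⇒b = ⊥-elim (true≢false (a⇒b refl) refl)

count-mono : {p q : Subset n} → p ⊆ q → count p ≤ count q
count-mono {p = p} {q} p⊆q =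
  subst₂ _≤_ (sym (count≡sum p)) (sym (count≡sum q)) (sum-mono-≤ (λ i → χ-mono (p⊆q i)))

count-mono-< : {p q : Subset n} → p ⊆ q → ∀ j → p j ≡ false → q j ≡ true → count p < count q
count-mono-< {p = p} {q} p⊆q j pj qj = subst₂ _<_ (sym (count≡sum p)) (sym (count≡sum q))
  (sum-mono-< (λ i → χ-mono (p⊆q i)) j (subst₂ (λ a b → χ a < χ b) (sym pj) (sym qj) ≤-refl))

count-∪-∩ : (p q : Subset n) → count (p ∪ q) + count (p ∩ q) ≡ count p + count q
count-∪-∩ p q = trans (count-+ (p ∪ q) (p ∩ q))
  (trans (sum-cong-≗ (λ i → χ-∨-∧ (p i) (q i))) (sym (count-+ p q)))
  where
  χ-∨-∧ : ∀ a b → χ (a ∨ b) + χ (a ∧ b) ≡ χ a + χ b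
  χ-∨-∧ true  true  = refl
  χ-∨-∧ true  false = refl
  χ-∨-∧ false true  = refl
  χ-∨-∧ false false = refl

count-∪ : (p q : Subset n) → count (p ∪ q) ≤ count p + count q
count-∪ p q = subst (count (p ∪ q) ≤_) (count-∪-∩ p q) (m≤m+n _ _)

count-submodular : {P Q A B : Subset n} → P ⊆ A ∪ B → Q ⊆ A ∩ B → count P + count Q ≤ count A + count B
count-submodular {A = A} {B} P⊆ Q⊆ =
  ≤-trans (+-mono-≤ (count-mono P⊆) (count-mono Q⊆)) (≤-reflexive (count-∪-∩ A B))

count-updateAt : ∀ (p : Subset n) a f → count (updateAt p a f) + χ (p a) ≡ count p + χ (f (p a))
count-updateAt p a f = begin
  count (updateAt p a f) + χ (p a)         ≡⟨ cong (_+ χ (p a)) (count≡sum (updateAt p a f)) ⟩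
  sum (χ ∘ updateAt p a f) + χ (p a)       ≡⟨ sum-agree-off a (λ j j≢a → cong χ (updateAt-minimal j a p j≢a)) ⟩
  sum (χ ∘ p) + χ (updateAt p a f a)       ≡⟨ cong₂ _+_ (sym (count≡sum p)) (cong χ (updateAt-updates a p)) ⟩
  count p + χ (f (p a))                    ∎
  where open ≡-Reasoning

count-insert : ∀ (p : Subset n) {a} → p a ≡ false → count (insert p a) ≡ suc (count p)
count-insert p {a} pa≡false = begin
  count (insert p a)             ≡⟨ +-identityʳ _ ⟨
  count (insert p a) + χ false   ≡⟨ cong (λ b → count (insert p a) + χ b) pa≡false ⟨
  count (insert p a) + χ (p a)   ≡⟨ count-updateAt p a (const true) ⟩
  count p + 1                    ≡⟨ +-comm (count p) 1 ⟩
  suc (count p)                  ∎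
  where open ≡-Reasoning

count-remove : ∀ (p : Subset n) a → count (remove p a) + χ (p a) ≡ count p
count-remove p a = trans (count-updateAt p a (const false)) (+-identityʳ (count p))

count-∅ : count (∅ {n}) ≡ 0
count-∅ {zero}  = refl
count-∅ {suc n} = count-∅ {n}

count-singleton : ∀ a → count (insert (∅ {n}) a) ≡ 1
count-singleton {n} a = trans (count-insert ∅ {a} refl) (cong suc (count-∅ {n}))

count-full : count (λ (_ : Fin n) → true) ≡ n
count-full {zero}  = refl
count-full {suc n} = cong suc (count-full {n})

count-full⇒true : ∀ (p : Subset n) → count p ≡ n → ∀ i → p i ≡ true
count-full⇒true {n} p |p|≡n i with p i in pi
... | true  = refl
... | false = ⊥-elim (<-irrefl |p|≡n (subst (count p <_) (count-full {n}) (count-mono-< (λ _ _ → refl) i pi refl)))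

count<⇒false : ∀ (p : Subset n) → count p < n → ∃[ i ] p i ≡ false
count<⇒false {n} p |p|<n with any? (λ i → p i ≟ᵇ false)
... | yes found = found
... | no  none  = ⊥-elim (<⇒≱ |p|<n (subst (_≤ count p) (count-full {n}) (count-mono (λ i _ → all-true i))))
  where
  all-true : ∀ i → p i ≡ true
  all-true i with p i in pi
  ... | true  = refl
  ... | false = ⊥-elim (none (i , pi))

weight : Subset n → (Fin n → ℕ) → ℕ
weight X c = sum (λ i → if X i then c i else 0)

weight-cong : ∀ {X Y : Subset n} c → X ≐ Y → weight X c ≡ weight Y c
weight-cong c X≐Y = sum-cong-≗ (λ i → cong (λ b → if b then c i else 0) (X≐Y i))

weight-mono : ∀ (X : Subset n) {c d} → (∀ i → X i ≡ true → c i ≤ d i) → weight X c ≤ weight X d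
weight-mono X c≤d = sum-mono-≤ term-mono
  where
  term-mono : ∀ i → (if X i then _ else 0) ≤ (if X i then _ else 0)
  term-mono i with X i in Xi
  ... | true  = c≤d i Xi
  ... | false = z≤n

weight-const : ∀ (X : Subset n) d → weight X (const d) ≡ d * count X
weight-const X d = begin
  weight X (const d)         ≡⟨ sum-cong-≗ term ⟩
  sum (λ i → d * χ (X i))    ≡⟨ *-distribˡ-sum d (χ ∘ X) ⟨
  d * sum (χ ∘ X)            ≡⟨ cong (d *_) (count≡sum X) ⟨
  d * count X                ∎
  where
  open ≡-Reasoning
  term : ∀ i → (if X i then d else 0) ≡ d * χ (X i)
  term i with X i
  ... | true  = sym (*-identityʳ d)
  ... | false = sym (*-zeroʳ d)

weight-*ˡ : ∀ (X : Subset n) q c → weight X (λ i → q * c i) ≡ q * weight X c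
weight-*ˡ X q c = trans (sum-cong-≗ term) (sym (*-distribˡ-sum q (λ i → if X i then c i else 0)))
  where
  term : ∀ i → (if X i then q * c i else 0) ≡ q * (if X i then c i else 0)
  term i with X i
  ... | true  = refl
  ... | false = sym (*-zeroʳ q)

weight-∪-∩ : ∀ (A B : Subset n) c → weight (A ∪ B) c + weight (A ∩ B) c ≡ weight A c + weight B c
weight-∪-∩ {n} A B c = begin
  weight (A ∪ B) c + weight (A ∩ B) c  ≡⟨ ∑-distrib-+ (term (A ∪ B)) (term (A ∩ B)) ⟨
  sum (λ i → term (A ∪ B) i + term (A ∩ B) i) ≡⟨ sum-cong-≗ (λ i → modular (A i) (B i) (c i)) ⟩
  sum (λ i → term A i + term B i)      ≡⟨ ∑-distrib-+ (term A) (term B) ⟩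
  weight A c + weight B c              ∎
  where
  open ≡-Reasoning
  term : Subset n → Fin n → ℕ
  term X i = if X i then c i else 0
  modular : ∀ a b x → (if a ∨ b then x else 0) + (if a ∧ b then x else 0)
                      ≡ (if a then x else 0) + (if b then x else 0)
  modular true  true  x = refl
  modular true  false x = refl
  modular false true  x = +-comm x 0
  modular false false x = refl

weight-updateAt-set : ∀ (X : Subset n) a f c →
  weight (updateAt X a f) c + (if X a then c a else 0) ≡ weight X c + (if f (X a) then c a else 0)
weight-updateAt-set X a f c = trans
  (sum-agree-off a (λ j j≢a → cong (λ b → if b then c j else 0) (updateAt-minimal j a X j≢a)))
  (cong (λ b → weight X c + (if b then c a else 0)) (updateAt-updates a X))

weight-insert : ∀ {X : Subset n} {a} c → X a ≡ false → weight (insert X a) c ≡ weight X c + c a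
weight-insert {X = X} {a} c Xa≡false = begin
  weight (insert X a) c                               ≡⟨ +-identityʳ _ ⟨
  weight (insert X a) c + 0                           ≡⟨ cong (λ b → weight (insert X a) c + (if b then c a else 0)) Xa≡false ⟨
  weight (insert X a) c + (if X a then c a else 0)    ≡⟨ weight-updateAt-set X a (const true) c ⟩
  weight X c + c a                                    ∎
  where open ≡-Reasoning

weight-remove : ∀ {X : Subset n} {a} c → X a ≡ true → weight X c ≡ weight (remove X a) c + c a
weight-remove {X = X} {a} c Xa≡true = begin
  weight X c                                          ≡⟨ +-identityʳ _ ⟨
  weight X c + 0                                      ≡⟨ weight-updateAt-set X a (const false) c ⟨
  weight (remove X a) c + (if X a then c a else 0)    ≡⟨ cong (λ b → weight (remove X a) c + (if b then c a else 0)) Xa≡true ⟩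
  weight (remove X a) c + c a                         ∎
  where open ≡-Reasoning

weight-updateAt-weights : ∀ (X : Subset n) c a f →
  weight X (updateAt c a f) + (if X a then c a else 0) ≡ weight X c + (if X a then f (c a) else 0)
weight-updateAt-weights X c a f = trans
  (sum-agree-off a (λ j j≢a → cong (λ x → if X j then x else 0) (updateAt-minimal j a c j≢a)))
  (cong (λ x → weight X c + (if X a then x else 0)) (updateAt-updates a c))

weight-pred : ∀ (X : Subset n) {c a} → 1 ≤ c a → weight X (updateAt c a pred) + χ (X a) ≡ weight X c
weight-pred X {c} {a} 1≤ca with X a | c a | weight-updateAt-weights X c a pred
... | false | _     | agree = trans agree (+-identityʳ _)
... | true  | suc x | agree = +-cancelʳ-≡ x _ _ (trans (+-assoc _ 1 x) agree)
... | true  | zero  | _     = ⊥-elim (1+n≰n 1≤ca)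

updateAt-pred-≤ : ∀ (c : Fin n → ℕ) a x → updateAt c a pred x ≤ c x
updateAt-pred-≤ c a x with x ≟ᶠ a
... | yes refl = ≤-trans (≤-reflexive (updateAt-updates x c)) pred[n]≤n
... | no  x≢a  = ≤-reflexive (updateAt-minimal x a c x≢a)

_◂_ : Bool → Subset n → Subset (suc n)
(b ◂ X) zero    = b
(b ◂ X) (suc i) = X i

◂-η : (R : Subset (suc n)) → R ≐ (R zero ◂ (R ∘ suc))
◂-η R zero    = refl
◂-η R (suc i) = refl

◂-cong : ∀ b {X Y : Subset n} → X ≐ Y → (b ◂ X) ≐ (b ◂ Y)
◂-cong b X≐Y zero    = refl
◂-cong b X≐Y (suc i) = X≐Y i

argmax : (Ψ : Subset n → ℕ) → (∀ {X Y} → X ≐ Y → Ψ X ≡ Ψ Y) → ∃[ H ] (∀ R → Ψ R ≤ Ψ H)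
argmax {zero}  Ψ Ψ-cong = ∅ , λ R → ≤-reflexive (Ψ-cong (λ ()))
argmax {suc n} Ψ Ψ-cong = best (Ψ (false ◂ H₀) ≤? Ψ (true ◂ H₁))
  where
  maximiser : ∀ b → ∃[ H ] (∀ R → Ψ (b ◂ R) ≤ Ψ (b ◂ H))
  maximiser b = argmax (Ψ ∘ (b ◂_)) (Ψ-cong ∘ ◂-cong b)
  H₀ H₁ : Subset n
  H₀ = proj₁ (maximiser false)
  H₁ = proj₁ (maximiser true)
  below-one : ∀ R → Ψ R ≤ Ψ (false ◂ H₀) ⊎ Ψ R ≤ Ψ (true ◂ H₁)
  below-one R with R zero | Ψ-cong (◂-η R)
  ... | false | ΨR≡ = inj₁ (subst (_≤ Ψ (false ◂ H₀)) (sym ΨR≡) (proj₂ (maximiser false) (R ∘ suc)))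
  ... | true  | ΨR≡ = inj₂ (subst (_≤ Ψ (true ◂ H₁)) (sym ΨR≡) (proj₂ (maximiser true) (R ∘ suc)))
  best : Dec (Ψ (false ◂ H₀) ≤ Ψ (true ◂ H₁)) → ∃[ H ] (∀ R → Ψ R ≤ Ψ H)
  best (yes ≤₁) = true ◂ H₁  , λ R → [ (λ ≤₀ → ≤-trans ≤₀ ≤₁) , id ]′ (below-one R)
  best (no ≰₁)  = false ◂ H₀ , λ R → [ id , (λ ≤₁ → ≤-trans ≤₁ (<⇒≤ (≰⇒> ≰₁))) ]′ (below-one R)

maximum-by-size : (P : Subset n → Set) → (∀ X → Dec (P X)) → (∀ {X Y} → X ≐ Y → P X → P Y) →
  P ∅ → ∃[ C ] P C × (∀ X → P X → count X ≤ count C)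
maximum-by-size {n} P P? P-resp P∅ = C , P-holds (maximal ∅) , λ X PX → largest X PX (maximal X)
  where
  size-if-P : Subset n → ℕ
  size-if-P X with P? X
  ... | yes _ = suc (count X)
  ... | no  _ = 0
  size-if-P-cong : ∀ {X Y} → X ≐ Y → size-if-P X ≡ size-if-P Y
  size-if-P-cong {X} {Y} X≐Y with P? X | P? Y
  ... | yes _  | yes _  = cong suc (count-cong X≐Y)
  ... | yes PX | no ¬PY = ⊥-elim (¬PY (P-resp X≐Y PX))
  ... | no ¬PX | yes PY = ⊥-elim (¬PX (P-resp (sym ∘ X≐Y) PY))
  ... | no _   | no _   = refl
  C : Subset n
  C = proj₁ (argmax size-if-P size-if-P-cong)
  maximal : ∀ X → size-if-P X ≤ size-if-P C
  maximal = proj₂ (argmax size-if-P size-if-P-cong)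
  P-holds : size-if-P ∅ ≤ size-if-P C → P C
  P-holds ∅≤C with P? ∅ | P? C
  P-holds _  | _      | yes PC = PC
  P-holds () | yes _  | no _
  P-holds _  | no ¬P∅ | no _   = ⊥-elim (¬P∅ P∅)
  largest : ∀ X → P X → size-if-P X ≤ size-if-P C → count X ≤ count C
  largest X PX X≤C with P? X | P? C
  largest X PX X≤C | yes _  | yes _ = s≤s⁻¹ X≤C
  largest X PX ()  | yes _  | no _
  largest X PX X≤C | no ¬PX | _     = ⊥-elim (¬PX PX)

-- Degrees, arcs and the handshake lemma

<ᵇ-exactly-one : ∀ {x y} → x ≢ y → χ (x <ᵇ y) + χ (y <ᵇ x) ≡ 1
<ᵇ-exactly-one {zero}  {zero}  x≢y = ⊥-elim (x≢y refl)
<ᵇ-exactly-one {zero}  {suc y} _   = refl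
<ᵇ-exactly-one {suc x} {zero}  _   = refl
<ᵇ-exactly-one {suc x} {suc y} x≢y = <ᵇ-exactly-one (x≢y ∘ cong suc)

module _ {n} (G : Graph n) where

  degreeIn : Subset n → Fin n → ℕ
  degreeIn R v = count (λ u → R u ∧ adj G v u)

  arcs : Subset n → Subset n → ℕ
  arcs A B = weight A (degreeIn B)

  arcs-double-sum : ∀ A B → arcs A B ≡ sum (λ i → sum (λ j → χ (A i ∧ (B j ∧ adj G i j))))
  arcs-double-sum A B = sum-cong-≗ row
    where
    row : ∀ i → (if A i then degreeIn B i else 0) ≡ sum (λ j → χ (A i ∧ (B j ∧ adj G i j)))
    row i with A i
    ... | true  = count≡sum (λ j → B j ∧ adj G i j)
    ... | false = sym (sum-replicate-zero n)

  arcs-comm : ∀ A B → arcs A B ≡ arcs B A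
  arcs-comm A B = begin
    arcs A B                                             ≡⟨ arcs-double-sum A B ⟩
    sum (λ i → sum (λ j → χ (A i ∧ (B j ∧ adj G i j))))  ≡⟨ ∑-comm (λ i j → χ (A i ∧ (B j ∧ adj G i j))) ⟩
    sum (λ j → sum (λ i → χ (A i ∧ (B j ∧ adj G i j))))  ≡⟨ sum-cong-≗ (λ j → sum-cong-≗ (λ i → cong χ (swap i j))) ⟩
    sum (λ j → sum (λ i → χ (B j ∧ (A i ∧ adj G j i))))  ≡⟨ arcs-double-sum B A ⟨
    arcs B A                                             ∎
    where
    open ≡-Reasoning
    swap : ∀ i j → A i ∧ (B j ∧ adj G i j) ≡ B j ∧ (A i ∧ adj G j i)
    swap i j rewrite adj-sym G j i with A i | B j
    ... | true  | true  = refl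
    ... | true  | false = refl
    ... | false | true  = refl
    ... | false | false = refl

  arcs-cong : ∀ {X Y} → X ≐ Y → arcs X X ≡ arcs Y Y
  arcs-cong X≐Y = sum-cong-≗ λ i →
    cong₂ (λ b d → if b then d else 0) (X≐Y i) (count-cong (λ j → cong (_∧ adj G i j) (X≐Y j)))

  arcs-∅ : arcs ∅ ∅ ≡ 0
  arcs-∅ = sum-replicate-zero n

  degreeIn-remove-self : ∀ R v → degreeIn (remove R v) v ≡ degreeIn R v
  degreeIn-remove-self R v = count-cong same
    where
    same : ∀ u → remove R v u ∧ adj G v u ≡ R u ∧ adj G v u
    same u with u ≟ᶠ v
    ... | yes refl rewrite irrefl G u | updateAt-updates u {const false} R with R u
    ...   | true  = refl
    ...   | false = refl
    same u | no u≢v = cong (_∧ adj G v u) (updateAt-minimal u v R u≢v)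

  degreeIn-insert : ∀ {R a} v → R a ≡ false → degreeIn (insert R a) v ≡ degreeIn R v + χ (adj G v a)
  degreeIn-insert {R} {a} v Ra = begin
    degreeIn (insert R a) v      ≡⟨ count-cong same ⟩
    count p′                     ≡⟨ +-identityʳ _ ⟨
    count p′ + 0                 ≡⟨ cong (λ b → count p′ + χ (b ∧ adj G v a)) Ra ⟨
    count p′ + χ (p a)           ≡⟨ count-updateAt p a (const (adj G v a)) ⟩
    degreeIn R v + χ (adj G v a) ∎
    where
    open ≡-Reasoning
    p : Subset n
    p u = R u ∧ adj G v u
    p′ : Subset n
    p′ = updateAt p a (const (adj G v a))
    same : ∀ u → insert R a u ∧ adj G v u ≡ updateAt p a (const (adj G v a)) u
    same u with u ≟ᶠ a
    ... | yes refl
      rewrite updateAt-updates u {const true} R | updateAt-updates u {const (adj G v u)} p = refl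
    ... | no  u≢a
      rewrite updateAt-minimal u a {const true} R u≢a | updateAt-minimal u a {const (adj G v a)} p u≢a = refl

  arcs-remove : ∀ {R} v → R v ≡ true →
    arcs R R ≡ arcs (remove R v) (remove R v) + degreeIn R v + degreeIn R v
  arcs-remove {R} v Rv = begin
    arcs R R                       ≡⟨ weight-remove (degreeIn R) Rv ⟩
    arcs R′ R + δ                  ≡⟨ cong (_+ δ) (arcs-comm R′ R) ⟩
    arcs R R′ + δ                  ≡⟨ cong (_+ δ) (weight-remove (degreeIn R′) Rv) ⟩
    arcs R′ R′ + degreeIn R′ v + δ ≡⟨ cong (λ d → arcs R′ R′ + d + δ) (degreeIn-remove-self R v) ⟩
    arcs R′ R′ + δ + δ             ∎
    where
    open ≡-Reasoning
    R′ : Subset n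
    R′ = remove R v
    δ : ℕ
    δ = degreeIn R v

  handshake : ∀ R → arcs R R ≡ 2 * edgesIn G R
  handshake R = begin
    arcs R R                                             ≡⟨ arcs-double-sum R R ⟩
    sum (λ i → sum (λ j → χ (R i ∧ (R j ∧ adj G i j))))  ≡⟨ sum-cong-≗ (λ i → sum-cong-≗ (split i)) ⟩
    sum (λ i → sum (λ j → L i j + L j i))                ≡⟨ sum-cong-≗ (λ i → ∑-distrib-+ (L i) (λ j → L j i)) ⟩
    sum (λ i → sum (L i) + sum (λ j → L j i))            ≡⟨ ∑-distrib-+ (λ i → sum (L i)) (λ i → sum (λ j → L j i)) ⟩
    E + sum (λ i → sum (λ j → L j i))                    ≡⟨ cong (E +_) (∑-comm (λ i j → L j i)) ⟩
    E + E                                                ≡⟨ cong (E +_) (+-identityʳ E) ⟨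
    2 * E                                                ≡⟨ cong (2 *_) edgesIn≡E ⟨
    2 * edgesIn G R                                      ∎
    where
    open ≡-Reasoning
    lower : Fin n → Fin n → Bool
    lower i j = R i ∧ R j ∧ adj G i j ∧ (toℕ i <ᵇ toℕ j)
    L : Fin n → Fin n → ℕ
    L i j = χ (lower i j)
    E : ℕ
    E = sum (λ i → sum (L i))
    edgesIn≡E : edgesIn G R ≡ E
    edgesIn≡E = trans (sumFin≡sum {n} _) (sum-cong-≗ (λ i → count≡sum (lower i)))
    split : ∀ i j → χ (R i ∧ (R j ∧ adj G i j)) ≡ L i j + L j i
    split i j rewrite adj-sym G j i with R i | R j | adj G i j in ij
    ... | true  | true  | true  = sym (<ᵇ-exactly-one (i≢j ∘ toℕ-injective))
      where
      i≢j : i ≢ j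
      i≢j refl = true≢false ij (irrefl G i)
    ... | true  | true  | false = refl
    ... | true  | false | _     = refl
    ... | false | true  | _     = refl
    ... | false | false | _     = refl

  -- A subgraph of large minimum degree

  V : Subset n
  V = const true

  -- q·2e(R) − e·|R|, shifted by e·n to stay in ℕ.
  potential : ℕ → ℕ → Subset n → ℕ
  potential q e R = q * arcs R R + e * count (not ∘ R)

  potential-cong : ∀ q e {X Y} → X ≐ Y → potential q e X ≡ potential q e Y
  potential-cong q e X≐Y = cong₂ (λ a b → q * a + e * b) (arcs-cong X≐Y) (count-cong (cong not ∘ X≐Y))

  potential-remove : ∀ q e {R} v → R v ≡ true →
    potential q e (remove R v) + (q * degreeIn R v + q * degreeIn R v) ≡ potential q e R + e
  potential-remove q e {R} v Rv = begin
    q * A + e * count (not ∘ remove R v) + (q * δ + q * δ)  ≡⟨ cong (λ c → q * A + e * c + (q * δ + q * δ)) complement-grows ⟩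
    q * A + e * suc N + (q * δ + q * δ)                     ≡⟨ rearrange q A δ e N ⟩
    q * (A + δ + δ) + e * N + e                             ≡⟨ cong (λ a → q * a + e * N + e) (arcs-remove v Rv) ⟨
    potential q e R + e                                     ∎
    where
    open ≡-Reasoning
    A δ N : ℕ
    A = arcs (remove R v) (remove R v)
    δ = degreeIn R v
    N = count (not ∘ R)
    rearrange : ∀ q A δ e N → q * A + e * suc N + (q * δ + q * δ) ≡ q * (A + δ + δ) + e * N + e
    rearrange = solve-∀
    complement-grows : count (not ∘ remove R v) ≡ suc N
    complement-grows = trans (count-cong same) (count-insert (not ∘ R) (cong not Rv))
      where
      same : ∀ u → not (remove R v u) ≡ insert (not ∘ R) v u
      same u with u ≟ᶠ v
      ... | yes refl = trans (cong not (updateAt-updates u R)) (sym (updateAt-updates u (not ∘ R)))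
      ... | no  u≢v  = trans (cong not (updateAt-minimal u v R u≢v)) (sym (updateAt-minimal u v (not ∘ R) u≢v))

  potential-∅ : ∀ q e → potential q e ∅ ≡ e * n
  potential-∅ q e = begin
    q * arcs ∅ ∅ + e * count {n} (const true)  ≡⟨ cong₂ (λ a b → q * a + e * b) arcs-∅ (count-full {n}) ⟩
    q * 0 + e * n                              ≡⟨ cong (_+ e * n) (*-zeroʳ q) ⟩
    e * n                                      ∎
    where open ≡-Reasoning

  potential-full : ∀ q e → potential q e V ≡ q * (2 * edges G)
  potential-full q e = begin
    q * arcs V V + e * count (∅ {n})  ≡⟨ cong₂ (λ a b → q * a + e * b) (handshake V) (count-∅ {n}) ⟩
    q * (2 * edges G) + e * 0         ≡⟨ cong (q * (2 * edges G) +_) (*-zeroʳ e) ⟩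
    q * (2 * edges G) + 0             ≡⟨ +-identityʳ _ ⟩
    q * (2 * edges G)                 ∎
    where open ≡-Reasoning

  min-degree-subgraph : ∀ d q → 0 < n → d * n ≤ q * edges G →
    ∃[ H ] (∃[ v ] H v ≡ true) × (∀ v → H v ≡ true → d ≤ q * degreeIn H v)
  min-degree-subgraph zero q 0<n _ = V , (fromℕ< 0<n , refl) , λ _ _ → z≤n
  min-degree-subgraph d@(suc d′) q 0<n dense = H , nonempty (any? (λ v → H v ≟ᵇ true)) , min-degree
    where
    e : ℕ
    e = d + d′
    H : Subset n
    H = proj₁ (argmax (potential q e) (potential-cong q e))
    maximal : ∀ R → potential q e R ≤ potential q e H
    maximal = proj₂ (argmax (potential q e) (potential-cong q e))

    min-degree : ∀ v → H v ≡ true → d ≤ q * degreeIn H v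
    min-degree v Hv = half-< (+-cancelˡ-≤ (potential q e (remove H v)) e (q * δ + q * δ) (begin
      potential q e (remove H v) + e                ≤⟨ +-monoˡ-≤ e (maximal (remove H v)) ⟩
      potential q e H + e                           ≡⟨ potential-remove q e v Hv ⟨
      potential q e (remove H v) + (q * δ + q * δ)  ∎))
      where
      open ≤-Reasoning
      δ : ℕ
      δ = degreeIn H v
      half-< : ∀ {a b} → suc (a + a) ≤ b + b → a < b
      half-< {a} {b} a+a<b+b with a <? b
      ... | yes a<b = a<b
      ... | no  a≮b = ⊥-elim (n≮n (a + a) (≤-trans a+a<b+b (+-mono-≤ (≮⇒≥ a≮b) (≮⇒≥ a≮b))))

    nonempty : Dec (∃[ v ] H v ≡ true) → ∃[ v ] H v ≡ true
    nonempty (yes v∈H) = v∈H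
    nonempty (no H≢∅)  = ⊥-elim (<⇒≱ (begin-strict
      e * n                          <⟨ *-monoˡ-< n {{>-nonZero 0<n}} (+-monoʳ-< d (n<1+n d′)) ⟩
      (d + d) * n                    ≡⟨ double d n ⟩
      2 * (d * n)                    ≤⟨ *-monoʳ-≤ 2 dense ⟩
      2 * (q * edges G)              ≡⟨ double-comm q (edges G) ⟩
      q * (2 * edges G)              ≡⟨ potential-full q e ⟨
      potential q e V                ∎)
      (begin
      potential q e V                ≤⟨ maximal V ⟩
      potential q e H                ≡⟨ potential-cong q e H≐∅ ⟩
      potential q e ∅                ≡⟨ potential-∅ q e ⟩
      e * n                          ∎))
      where
      open ≤-Reasoning
      double : ∀ d n → (d + d) * n ≡ 2 * (d * n)
      double = solve-∀
      double-comm : ∀ q e → 2 * (q * e) ≡ q * (2 * e)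
      double-comm = solve-∀
      H≐∅ : H ≐ ∅
      H≐∅ v with H v in Hv
      ... | true  = ⊥-elim (H≢∅ (v , Hv))
      ... | false = refl

  -- Neighbourhoods and expansion

  -- Opaque, since unfolded the term Γ H X u hides H, X and u from unification.
  opaque
    Γ : Subset n → Subset n → Subset n
    Γ H X u = H u ∧ does (any? (λ x → (X x ∧ adj G x u) ≟ᵇ true))

  opaque
    unfolding Γ

    Γ-intro : ∀ {H X u} x → H u ≡ true → X x ≡ true → adj G x u ≡ true → Γ H X u ≡ true
    Γ-intro {H} {X} {u} x Hu Xx xu rewrite Hu =
      dec-true (any? (λ x → (X x ∧ adj G x u) ≟ᵇ true)) (x , cong₂ _∧_ Xx xu)

    Γ-elim : ∀ {H X u} → Γ H X u ≡ true → H u ≡ true × ∃[ x ] X x ≡ true × adj G x u ≡ true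
    Γ-elim {H} {X} {u} u∈Γ with ∧-true {H u} u∈Γ
    ... | Hu , found with any? (λ x → (X x ∧ adj G x u) ≟ᵇ true)
    ...   | yes (x , Xx∧xu) = Hu , x , ∧-true Xx∧xu

  Γ-mono : ∀ {H X Y} → X ⊆ Y → Γ H X ⊆ Γ H Y
  Γ-mono X⊆Y u u∈ΓX with Γ-elim u∈ΓX
  ... | Hu , x , Xx , xu = Γ-intro x Hu (X⊆Y x Xx) xu

  Γ-cong : ∀ {H X Y} → X ≐ Y → Γ H X ≐ Γ H Y
  Γ-cong X≐Y u = true⇔true⇒≡ (Γ-mono (λ i → subst (_≡ true) (X≐Y i)) u)
                             (Γ-mono (λ i → subst (_≡ true) (sym (X≐Y i))) u)

  Γ-∪ : ∀ {H} A B → Γ H (A ∪ B) ⊆ Γ H A ∪ Γ H B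
  Γ-∪ {H} A B u u∈Γ with Γ-elim u∈Γ
  ... | Hu , x , A∪Bx , xu with ∨-true {A x} A∪Bx
  ...   | inj₁ Ax = ∨-introˡ (Γ H B u) (Γ-intro x Hu Ax xu)
  ...   | inj₂ Bx = ∨-introʳ (Γ H A u) (Γ-intro x Hu Bx xu)

  sparse⇒expansion : ∀ {H} p q s b .{{_ : NonZero p}} →
    (∀ v → H v ≡ true → 2 * p * s ≤ q * degreeIn H v) →
    (∀ R → count R ≤ s * b → edgesIn G R * q ≤ p * count R) →
    ∀ X → X ⊆ H → count X ≤ b → s * count X ≤ count (X ∪ Γ H X)
  sparse⇒expansion {H} p q s b min-degree sparse X X⊆H X≤b = by-size (count U ≤? s * b)
    where
    open ≤-Reasoning
    U : Subset n
    U = X ∪ Γ H X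
    double-comm : ∀ q e → q * (2 * e) ≡ 2 * (e * q)
    double-comm = solve-∀
    X-degrees≤U-degrees : ∀ v → (if X v then degreeIn H v else 0) ≤ (if U v then degreeIn U v else 0)
    X-degrees≤U-degrees v with X v in Xv
    ... | false = z≤n
    ... | true  = count-mono λ u Hu∧vu → let (Hu , vu) = ∧-true Hu∧vu in
                    cong₂ _∧_ (∨-introʳ (X u) (Γ-intro v Hu Xv vu)) vu
    by-size : Dec (count U ≤ s * b) → s * count X ≤ count U
    by-size (no  U≰sb) = ≤-trans (*-monoʳ-≤ s X≤b) (<⇒≤ (≰⇒> U≰sb))
    by-size (yes U≤sb) = *-cancelˡ-≤ (2 * p) {{m*n≢0 2 p}} (begin
      2 * p * (s * count X)                ≡⟨ *-assoc (2 * p) s (count X) ⟨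
      2 * p * s * count X                  ≡⟨ weight-const X (2 * p * s) ⟨
      weight X (const (2 * p * s))         ≤⟨ weight-mono X (λ v → min-degree v ∘ X⊆H v) ⟩
      weight X (λ v → q * degreeIn H v)    ≡⟨ weight-*ˡ X q (degreeIn H) ⟩
      q * weight X (degreeIn H)            ≤⟨ *-monoʳ-≤ q (sum-mono-≤ X-degrees≤U-degrees) ⟩
      q * arcs U U                         ≡⟨ cong (q *_) (handshake U) ⟩
      q * (2 * edgesIn G U)                ≡⟨ double-comm q (edgesIn G U) ⟩
      2 * (edgesIn G U * q)                ≤⟨ *-monoʳ-≤ 2 (sparse U U≤sb) ⟩
      2 * (p * count U)                    ≡⟨ *-assoc 2 p (count U) ⟨
      2 * p * count U                      ∎)

-- The Friedman–Pippenger extension step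

Expanding : Graph n → Subset n → ℕ → ℕ → Set
Expanding G H k m = ∀ X → X ⊆ H → count X ≤ 2 * m → suc k * count X ≤ count (Γ G H X)

-- F is the current image of the tree and c x the number of tree edges at x still to be embedded.
module FriedmanPippenger {n} (G : Graph n) (H : Subset n) (m : ℕ) where

  free : Subset n → Subset n → ℕ
  free F X = count (Γ G H X ∖ F)

  Good : Subset n → (Fin n → ℕ) → Set
  Good F c = ∀ X → X ⊆ H → count X ≤ 2 * m → weight X c ≤ free F X

  Critical : Subset n → (Fin n → ℕ) → Fin n → Subset n → Set
  Critical F c v X = X ⊆ H × count X ≤ 2 * m × X v ≡ false × free F X ≤ weight X c

  |Γ|≤free+|F| : ∀ F X → count (Γ G H X) ≤ free F X + count F
  |Γ|≤free+|F| F X = ≤-trans (count-mono (⊆-∖-∪ (Γ G H X) F)) (count-∪ (Γ G H X ∖ F) F)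

  free-submodular : ∀ F A B → free F (A ∪ B) + free F (A ∩ B) ≤ free F A + free F B
  free-submodular F A B = count-submodular
    (⊆-trans (∖-mono F (Γ-∪ G A B)) (∖-∪ (Γ G H A) (Γ G H B) F))
    (⊆-trans (∖-mono F (∩-⊆-intro (Γ-mono G (∩-⊆ˡ A B)) (Γ-mono G (∩-⊆ʳ A B))))
             (∖-∩ (Γ G H A) (Γ G H B) F))

  free-∅ : ∀ F → free F ∅ ≡ 0
  free-∅ F = n≤0⇒n≡0 (≤-trans (count-mono nothing) (≤-reflexive (count-∅ {n})))
    where
    nothing : Γ G H ∅ ∖ F ⊆ ∅
    nothing u u∈ with Γ-elim G (proj₁ (∧-true u∈))
    ... | _ , _ , () , _

  critical? : ∀ F c v X → Dec (Critical F c v X)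
  critical? F c v X = X ⊆? H ×-dec count X ≤? 2 * m ×-dec X v ≟ᵇ false ×-dec free F X ≤? weight X c

  critical-resp : ∀ {F c v X Y} → X ≐ Y → Critical F c v X → Critical F c v Y
  critical-resp {F} {c} X≐Y (X⊆H , small , Xv , tight) =
    (λ i → X⊆H i ∘ subst (_≡ true) (sym (X≐Y i))) ,
    subst (_≤ 2 * m) (count-cong X≐Y) small ,
    trans (sym (X≐Y _)) Xv ,
    subst₂ _≤_ (count-cong (λ u → cong (_∧ not (F u)) (Γ-cong G X≐Y u))) (weight-cong c X≐Y) tight

  ∅-critical : ∀ F c v → Critical F c v ∅
  ∅-critical F c v =
    (λ _ ()) , subst (_≤ 2 * m) (sym (count-∅ {n})) z≤n , refl ,
    ≤-reflexive (trans (free-∅ F) (sym (sum-replicate-zero n)))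

  free-insert : ∀ {F z} X → F z ≡ false → free (insert F z) X + χ (Γ G H X z) ≡ free F X
  free-insert {F} {z} X Fz = begin
    free (insert F z) X + χ (Γ G H X z)  ≡⟨ cong₂ _+_ (count-cong (∖-insert (Γ G H X) F z)) (cong χ z∉F) ⟩
    count (remove P z) + χ (P z)         ≡⟨ count-remove P z ⟩
    free F X                             ∎
    where
    open ≡-Reasoning
    P : Subset n
    P = Γ G H X ∖ F
    z∉F : Γ G H X z ≡ P z
    z∉F = sym (trans (cong (λ b → Γ G H X z ∧ not b) Fz) (∧-identityʳ _))

  good-after-extension : ∀ {F c v z} → Good F c → (∀ x → F x ≡ false → 1 ≤ c x) →
    F v ≡ true → 1 ≤ c v → F z ≡ false → (∀ X → Critical F c v X → Γ G H X z ≡ false) →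
    Good (insert F z) (updateAt (updateAt c v pred) z pred)
  good-after-extension {F} {c} {v} {z} good c-free Fv 1≤cv Fz avoids-critical X X⊆H small =
    fits (Γ G H X z) refl
    where
    W′ O′ : ℕ
    W′ = weight X (updateAt (updateAt c v pred) z pred)
    O′ = free (insert F z) X
    W≤O : weight X c ≤ free F X
    W≤O = good X X⊆H small
    z≢v : z ≢ v
    z≢v refl = true≢false Fv Fz
    1≤c₁z : 1 ≤ updateAt c v pred z
    1≤c₁z = subst (1 ≤_) (sym (updateAt-minimal z v c z≢v)) (c-free z Fz)
    weights : W′ + χ (X z) + χ (X v) ≡ weight X c
    weights = trans (cong (_+ χ (X v)) (weight-pred X 1≤c₁z)) (weight-pred X 1≤cv)
    <-weight : ∀ {a b} → W′ + a + b ≡ weight X c → 0 < a + b → W′ < weight X c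
    <-weight {a} {b} W≡ 0<a+b = subst (W′ <_) (trans (sym (+-assoc W′ a b)) W≡) (m<m+n W′ 0<a+b)
    -- Losing the free neighbour z is paid for by v or z lying in X, or else by X not being critical.
    W′<O : Γ G H X z ≡ true → W′ < free F X
    W′<O z∈ΓX with X z | X v in Xv | weights
    ... | true  | _     | W≡ = <-≤-trans (<-weight W≡ (s≤s z≤n)) W≤O
    ... | false | true  | W≡ = <-≤-trans (<-weight W≡ (s≤s z≤n)) W≤O
    ... | false | false | W≡ with free F X ≤? weight X c
    ...   | yes O≤W = ⊥-elim (true≢false z∈ΓX (avoids-critical X (X⊆H , small , Xv , O≤W)))
    ...   | no  O≰W = subst (_< free F X) (trans (sym W≡) (trans (+-identityʳ _) (+-identityʳ W′))) (≰⇒> O≰W)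
    fits : ∀ b → Γ G H X z ≡ b → W′ ≤ O′
    fits false z∉ΓX = begin
      W′                        ≤⟨ ≤-trans (m≤m+n W′ _) (m≤m+n _ _) ⟩
      W′ + χ (X z) + χ (X v)    ≡⟨ weights ⟩
      weight X c                ≤⟨ W≤O ⟩
      free F X                  ≡⟨ free-insert X Fz ⟨
      O′ + χ (Γ G H X z)        ≡⟨ cong (λ b → O′ + χ b) z∉ΓX ⟩
      O′ + 0                    ≡⟨ +-identityʳ O′ ⟩
      O′                        ∎
      where open ≤-Reasoning
    fits true z∈ΓX = ≤-pred (begin
      suc W′                    ≤⟨ W′<O z∈ΓX ⟩
      free F X                  ≡⟨ free-insert X Fz ⟨
      O′ + χ (Γ G H X z)        ≡⟨ cong (λ b → O′ + χ b) z∈ΓX ⟩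
      O′ + 1                    ≡⟨ +-comm O′ 1 ⟩
      suc O′                    ∎)
      where open ≤-Reasoning

module _ {n} (G : Graph n) (H : Subset n) (k m : ℕ) (expanding : Expanding G H k m) where

  open FriedmanPippenger G H m

  critical-small : ∀ {F c X} → (∀ x → c x ≤ k) → X ⊆ H → count X ≤ 2 * m → free F X ≤ weight X c →
    count X ≤ count F
  critical-small {F} {c} {X} c≤k X⊆H small tight = +-cancelˡ-≤ (k * count X) (count X) (count F) (begin
    k * count X + count X     ≡⟨ +-comm (k * count X) (count X) ⟩
    suc k * count X           ≤⟨ expanding X X⊆H small ⟩
    count (Γ G H X)           ≤⟨ |Γ|≤free+|F| F X ⟩
    free F X + count F        ≤⟨ +-monoˡ-≤ (count F) tight ⟩
    weight X c + count F      ≤⟨ +-monoˡ-≤ (count F) (weight-mono X (λ i _ → c≤k i)) ⟩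
    weight X (const k) + count F ≡⟨ cong (_+ count F) (weight-const X k) ⟩
    k * count X + count F     ∎)
    where open ≤-Reasoning

  critical-∪ : ∀ {F c v A B} → Good F c → count F ≤ m → (∀ x → c x ≤ k) →
    Critical F c v A → Critical F c v B → Critical F c v (A ∪ B)
  critical-∪ {F} {c} {v} {A} {B} good F≤m c≤k (A⊆H , A-small , Av , A-tight) (B⊆H , B-small , Bv , B-tight) =
    A∪B⊆H , A∪B-small , cong₂ _∨_ Av Bv , A∪B-tight
    where
    open ≤-Reasoning
    A∪B⊆H : A ∪ B ⊆ H
    A∪B⊆H i A∪Bi with ∨-true {A i} A∪Bi
    ... | inj₁ Ai = A⊆H i Ai
    ... | inj₂ Bi = B⊆H i Bi
    A∩B⊆H : A ∩ B ⊆ H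
    A∩B⊆H = ⊆-trans (∩-⊆ˡ A B) A⊆H
    A∩B-small : count (A ∩ B) ≤ 2 * m
    A∩B-small = ≤-trans (count-mono (∩-⊆ˡ A B)) A-small
    A∪B-small : count (A ∪ B) ≤ 2 * m
    A∪B-small = begin
      count (A ∪ B)          ≤⟨ count-∪ A B ⟩
      count A + count B      ≤⟨ +-mono-≤ (critical-small c≤k A⊆H A-small A-tight)
                                         (critical-small c≤k B⊆H B-small B-tight) ⟩
      count F + count F      ≤⟨ +-mono-≤ F≤m F≤m ⟩
      m + m                  ≡⟨ cong (m +_) (+-identityʳ m) ⟨
      2 * m                  ∎
    A∪B-tight : free F (A ∪ B) ≤ weight (A ∪ B) c
    A∪B-tight = +-cancelʳ-≤ (free F (A ∩ B)) (free F (A ∪ B)) (weight (A ∪ B) c) (begin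
      free F (A ∪ B) + free F (A ∩ B)      ≤⟨ free-submodular F A B ⟩
      free F A + free F B                  ≤⟨ +-mono-≤ A-tight B-tight ⟩
      weight A c + weight B c              ≡⟨ weight-∪-∩ A B c ⟨
      weight (A ∪ B) c + weight (A ∩ B) c  ≤⟨ +-monoʳ-≤ (weight (A ∪ B) c) (good (A ∩ B) A∩B⊆H A∩B-small) ⟩
      weight (A ∪ B) c + free F (A ∩ B)    ∎)

  maximum-critical : ∀ {F c} v → Good F c → count F ≤ m → (∀ x → c x ≤ k) →
    ∃[ C ] Critical F c v C × (∀ X → Critical F c v X → X ⊆ C)
  maximum-critical {F} {c} v good F≤m c≤k
    with maximum-by-size (Critical F c v) (critical? F c v) critical-resp (∅-critical F c v)
  ... | C , C-critical , largest = C , C-critical , contains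
    where
    contains : ∀ X → Critical F c v X → X ⊆ C
    contains X X-critical i Xi with C i in Ci
    ... | true  = refl
    ... | false = ⊥-elim (<⇒≱ (count-mono-< (λ j → ∨-introʳ (X j)) i Ci (∨-introˡ (C i) Xi))
                                 (largest (X ∪ C) (critical-∪ good F≤m c≤k X-critical C-critical)))

  good-singleton : ∀ v → Good (insert ∅ v) (const k)
  good-singleton v X X⊆H small with count X in |X|
  ... | zero  = ≤-trans (≤-reflexive (trans (weight-const X k) (trans (cong (k *_) |X|) (*-zeroʳ k)))) z≤n
  ... | suc x = ≤-pred (begin
    suc (weight X (const k))         ≡⟨ cong suc (trans (weight-const X k) (cong (k *_) |X|)) ⟩
    suc (k * suc x)                  ≤⟨ s≤s (m≤n+m (k * suc x) x) ⟩
    suc k * suc x                    ≡⟨ cong (suc k *_) |X| ⟨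
    suc k * count X                  ≤⟨ expanding X X⊆H (subst (_≤ 2 * m) (sym |X|) small) ⟩
    count (Γ G H X)                  ≤⟨ |Γ|≤free+|F| (insert ∅ v) X ⟩
    free (insert ∅ v) X + count (insert ∅ v) ≡⟨ cong (free (insert ∅ v) X +_) (count-singleton v) ⟩
    free (insert ∅ v) X + 1          ≡⟨ +-comm _ 1 ⟩
    suc (free (insert ∅ v) X)        ∎)
    where open ≤-Reasoning

  unblocked-neighbour : ∀ {F c v C} → Good F c → F ⊆ H → count F < m → (∀ x → c x ≤ k) →
    F v ≡ true → 1 ≤ c v → Critical F c v C →
    ∃[ z ] H z ≡ true × F z ≡ false × adj G v z ≡ true × Γ G H C z ≡ false
  unblocked-neighbour {F} {c} {v} {C} good F⊆H F<m c≤k Fv 1≤cv (C⊆H , C-small , Cv , C-tight)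
    with any? (λ z → H z ∧ not (F z) ∧ adj G v z ∧ not (Γ G H C z) ≟ᵇ true)
  ... | yes (z , found) =
    let Hz , rest = ∧-true {H z} found
        ¬Fz , rest′ = ∧-true {not (F z)} rest
        vz , ¬ΓCz = ∧-true {adj G v z} rest′
    in z , Hz , not-true ¬Fz , vz , not-true ¬ΓCz
  -- Otherwise every free neighbour of v lies in Γ(C), so C ∪ {v} violates goodness.
  ... | no none = ⊥-elim (<⇒≱ 1≤cv (+-cancelˡ-≤ (weight C c) (c v) 0 (begin
    weight C c + c v          ≡⟨ weight-insert c Cv ⟨
    weight (insert C v) c     ≤⟨ good (insert C v) C+v⊆H C+v-small ⟩
    free F (insert C v)       ≤⟨ count-mono neighbours-of-v-blocked ⟩
    free F C                  ≤⟨ C-tight ⟩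
    weight C c                ≡⟨ +-identityʳ _ ⟨
    weight C c + 0            ∎)))
    where
    open ≤-Reasoning
    C+v⊆H : insert C v ⊆ H
    C+v⊆H i i∈ with ∈-insert⁻ C v i i∈
    ... | inj₁ refl = F⊆H v Fv
    ... | inj₂ Ci   = C⊆H i Ci
    C+v-small : count (insert C v) ≤ 2 * m
    C+v-small = begin
      count (insert C v)      ≡⟨ count-insert C Cv ⟩
      suc (count C)           ≤⟨ s≤s (critical-small c≤k C⊆H C-small C-tight) ⟩
      suc (count F)           ≤⟨ F<m ⟩
      m                       ≤⟨ m≤m+n m (m + 0) ⟩
      2 * m                   ∎
    neighbours-of-v-blocked : Γ G H (insert C v) ∖ F ⊆ Γ G H C ∖ F
    neighbours-of-v-blocked u u∈ with ∧-true {Γ G H (insert C v) u} u∈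
    ... | u∈Γ , ¬Fu with Γ-elim G u∈Γ
    ...   | Hu , x , x∈ , xu with ∈-insert⁻ C v x x∈
    ...     | inj₂ Cx   = cong₂ _∧_ (Γ-intro G x Hu Cx xu) ¬Fu
    ...     | inj₁ refl with Γ G H C u in ΓCu
    ...       | true  = ¬Fu
    ...       | false = ⊥-elim (none (u , cong₂ _∧_ Hu (cong₂ _∧_ ¬Fu (cong₂ _∧_ xu (cong not ΓCu)))))

  extend : ∀ {F c v} → Good F c → F ⊆ H → count F < m → (∀ x → c x ≤ k) →
    (∀ x → F x ≡ false → 1 ≤ c x) → F v ≡ true → 1 ≤ c v →
    ∃[ z ] H z ≡ true × F z ≡ false × adj G v z ≡ true × Good (insert F z) (updateAt (updateAt c v pred) z pred)
  extend {F} {c} {v} good F⊆H F<m c≤k c-free Fv 1≤cv =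
    let C , C-critical , maximum = maximum-critical v good (<⇒≤ F<m) c≤k
        z , Hz , Fz , vz , z∉ΓC = unblocked-neighbour good F⊆H F<m c≤k Fv 1≤cv C-critical
    in z , Hz , Fz , vz , good-after-extension good c-free Fv 1≤cv Fz
                            (λ X X-critical → ⊆-false (Γ-mono G (maximum X X-critical)) z∉ΓC)

module _ {m} (T : Graph m) where

  open import Data.List.Membership.DecPropositional (_≟ᶠ_ {m}) using (_∈?_)

  data WalkIn (S : Subset m) : Fin m → Fin m → Set where
    here : ∀ {u} → WalkIn S u u
    step : ∀ {u w v} → adj T u w ≡ true → S w ≡ true → WalkIn S w v → WalkIn S u v

  vertices : ∀ {S u v} → WalkIn S u v → List (Fin m)
  vertices here                 = []
  vertices (step {w = w} _ _ p) = w ∷ vertices p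

  vertices-in : ∀ {S u v} (p : WalkIn S u v) → All (λ x → S x ≡ true) (vertices p)
  vertices-in here           = []
  vertices-in (step _ Sw p)  = Sw ∷ vertices-in p

  snoc : ∀ {S u v x} → WalkIn S u v → adj T v x ≡ true → S x ≡ true → WalkIn S u x
  snoc here          vx Sx = step vx Sx here
  snoc (step uw Sw p) vx Sx = step uw Sw (snoc p vx Sx)

  weaken : ∀ {S S′ u v} → S ⊆ S′ → WalkIn S u v → WalkIn S′ u v
  weaken S⊆S′ here           = here
  weaken S⊆S′ (step uw Sw p) = step uw (S⊆S′ _ Sw) (weaken S⊆S′ p)

  walk⇒PathAdj : ∀ {S u v x} (p : WalkIn S u v) → adj T v x ≡ true → PathAdj T u (vertices p) x
  walk⇒PathAdj here           vx = vx
  walk⇒PathAdj (step uw _ p)  vx = uw , walk⇒PathAdj p vx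

  suffix : ∀ {S a u v} (p : WalkIn S a v) → Unique (a ∷ vertices p) → u ∈ a ∷ vertices p →
    Σ[ q ∈ WalkIn S u v ] Unique (u ∷ vertices q)
  suffix p              distinct        (Any.here refl) = p , distinct
  suffix (step _ _ p)   (_ ∷ distinct)  (Any.there u∈)  = suffix p distinct u∈

  erase-loops : ∀ {S u v} → WalkIn S u v → Σ[ q ∈ WalkIn S u v ] Unique (u ∷ vertices q)
  erase-loops here = here , [] ∷ []
  erase-loops {u = u} (step {w = w} uw Sw p) with erase-loops p
  ... | q , distinct with u ∈? w ∷ vertices q
  ...   | yes u∈ = suffix q distinct u∈
  ...   | no  u∉ = step uw Sw q , ¬Any⇒All¬ (w ∷ vertices q) u∉ ∷ distinct

  unique-neighbour : Acyclic T → ∀ {S} → (∀ {t t′} → S t ≡ true → S t′ ≡ true → WalkIn S t t′) →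
    ∀ {y y₂ y′} → S y ≡ true → S y₂ ≡ true → S y′ ≡ false →
    adj T y y′ ≡ true → adj T y₂ y′ ≡ true → y₂ ≡ y
  unique-neighbour acyclic {S} connected {y} {y₂} {y′} Sy Sy₂ Sy′ yy′ y₂y′ with y₂ ≟ᶠ y
  ... | yes y₂≡y = y₂≡y
  ... | no  y₂≢y with erase-loops (connected Sy Sy₂)
  ...   | here , _ = ⊥-elim (y₂≢y refl)
  ...   | p@(step _ _ _) , distinct = ⊥-elim (acyclic (record
          { start    = y′
          ; rest     = y ∷ vertices p
          ; long     = s≤s (s≤s z≤n)
          ; distinct = (y′∉S Sy ∷ All.map y′∉S (vertices-in p)) ∷ distinct
          ; closed   = trans (adj-sym T y′ y) yy′ , walk⇒PathAdj p y₂y′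
          }))
    where
    y′∉S : ∀ {x} → S x ≡ true → y′ ≢ x
    y′∉S Sx refl = true≢false Sx Sy′

  crossing-edge : ∀ (S : Subset m) {u w} → Walk T u w → S u ≡ true → S w ≡ false →
    ∃[ a ] ∃[ b ] S a ≡ true × S b ≡ false × adj T a b ≡ true
  crossing-edge S here          Su Sw = ⊥-elim (true≢false Su Sw)
  crossing-edge S {u} (step {w = w} uw p) Su Sx with S w in Sw
  ... | true  = crossing-edge S p Sw Sx
  ... | false = u , w , Su , Sw , uw

-- Greedy embedding of a bounded-degree tree

module _ {n m} (G : Graph n) (H : Subset n) (k : ℕ) (expanding : Expanding G H k m)
         (T : Graph m) (t₀ : Fin m) (T-connected : Connected T) (T-acyclic : Acyclic T)
         (T-max-degree : MaxDegreeAtMost T k) where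

  open FriedmanPippenger G H m

  record PartialEmbedding : Set where
    field
      S : Subset m
      F : Subset n
      f : Fin m → Fin n
      c : Fin n → ℕ
      t₀∈S          : S t₀ ≡ true
      |S|≡|F|       : count S ≡ count F
      S-connected   : ∀ {t t′} → S t ≡ true → S t′ ≡ true → WalkIn T S t t′
      f-into        : ∀ {t} → S t ≡ true → F (f t) ≡ true
      f-injective   : ∀ {t t′} → S t ≡ true → S t′ ≡ true → f t ≡ f t′ → t ≡ t′
      f-homomorphic : ∀ {t t′} → S t ≡ true → S t′ ≡ true → adj T t t′ ≡ true → adj G (f t) (f t′) ≡ true
      c-remaining   : ∀ {t} → S t ≡ true → c (f t) + degreeIn T S t ≡ k
      c≤k           : ∀ x → c x ≤ k
      c-unused      : ∀ {x} → F x ≡ false → c x ≡ k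
      F⊆H           : F ⊆ H
      good          : Good F c

  module E = PartialEmbedding

  singleton-embedding : ∀ {v₀} → H v₀ ≡ true → PartialEmbedding
  singleton-embedding {v₀} Hv₀ = record
    { S = insert ∅ t₀ ; F = insert ∅ v₀ ; f = const v₀ ; c = const k
    ; t₀∈S          = updateAt-updates t₀ ∅
    ; |S|≡|F|       = trans (count-singleton t₀) (sym (count-singleton v₀))
    ; S-connected   = λ St St′ → subst₂ (WalkIn T _) (sym (only-t₀ St)) (sym (only-t₀ St′)) here
    ; f-into        = λ _ → updateAt-updates v₀ ∅
    ; f-injective   = λ St St′ _ → trans (only-t₀ St) (sym (only-t₀ St′))
    ; f-homomorphic = λ St St′ tt′ → ⊥-elim (no-loop St St′ tt′)
    ; c-remaining   = λ St → trans (cong (k +_) (no-neighbours St)) (+-identityʳ k)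
    ; c≤k           = λ _ → ≤-refl
    ; c-unused      = λ _ → refl
    ; F⊆H           = λ x x∈ → subst (λ u → H u ≡ true) (sym (∈-singleton⁻ v₀ x x∈)) Hv₀
    ; good          = good-singleton G H k m expanding v₀
    }
    where
    only-t₀ : ∀ {t} → insert ∅ t₀ t ≡ true → t ≡ t₀
    only-t₀ {t} = ∈-singleton⁻ t₀ t
    no-loop : ∀ {t t′} → insert ∅ t₀ t ≡ true → insert ∅ t₀ t′ ≡ true → adj T t t′ ≢ true
    no-loop St St′ tt′ rewrite only-t₀ St | only-t₀ St′ = true≢false tt′ (irrefl T t₀)
    no-neighbours : ∀ {t} → insert ∅ t₀ t ≡ true → degreeIn T (insert ∅ t₀) t ≡ 0
    no-neighbours {t} St rewrite degreeIn-insert T {∅} {t₀} t refl | only-t₀ St | irrefl T t₀ =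
      trans (+-identityʳ _) (count-∅ {m})

  spare-capacity : ∀ (e : PartialEmbedding) {y y′} →
    E.S e y ≡ true → E.S e y′ ≡ false → adj T y y′ ≡ true → 1 ≤ E.c e (E.f e y)
  spare-capacity e {y} {y′} Sy Sy′ yy′ with E.c e (E.f e y) | E.c-remaining e Sy
  ... | suc _ | _         = s≤s z≤n
  ... | zero  | deg≡k     = ⊥-elim (<-irrefl deg≡k (<-≤-trans deg<degree (T-max-degree y)))
    where
    deg<degree : degreeIn T (E.S e) y < degree T y
    deg<degree = count-mono-< (λ u → proj₂ ∘ ∧-true {E.S e u}) y′ (cong (_∧ adj T y y′) Sy′) yy′

  module Grow (e : PartialEmbedding) {y y′ z}
              (Sy : E.S e y ≡ true) (Sy′ : E.S e y′ ≡ false) (yy′ : adj T y y′ ≡ true)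
              (Hz : H z ≡ true) (Fz : E.F e z ≡ false) (fy-z : adj G (E.f e y) z ≡ true)
              (good′ : Good (insert (E.F e) z) (updateAt (updateAt (E.c e) (E.f e y) pred) z pred))
              where

    open PartialEmbedding e

    S′ : Subset m
    S′ = insert S y′
    F′ : Subset n
    F′ = insert F z
    f′ : Fin m → Fin n
    f′ = updateAt f y′ (const z)
    c′ : Fin n → ℕ
    c′ = updateAt (updateAt c (f y) pred) z pred

    y′∈S′ : S′ y′ ≡ true
    y′∈S′ = updateAt-updates y′ S

    S⊆S′ : S ⊆ S′
    S⊆S′ = ⊆-insert S y′

    new-or-old : ∀ {t} → S′ t ≡ true → t ≡ y′ ⊎ S t ≡ true
    new-or-old {t} = ∈-insert⁻ S y′ t

    f′-new : f′ y′ ≡ z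
    f′-new = updateAt-updates y′ f

    f′-old : ∀ {t} → S t ≡ true → f′ t ≡ f t
    f′-old {t} St = updateAt-minimal t y′ f λ { refl → true≢false St Sy′ }

    z-fresh : ∀ {t} → S t ≡ true → f t ≢ z
    z-fresh St ft≡z = true≢false (subst (λ x → F x ≡ true) ft≡z (f-into St)) Fz

    only-neighbour : ∀ {t} → S t ≡ true → adj T t y′ ≡ true → t ≡ y
    only-neighbour St ty′ = unique-neighbour T T-acyclic S-connected Sy St Sy′ yy′ ty′

    y′y : adj T y′ y ≡ true
    y′y = trans (adj-sym T y′ y) yy′

    S′-connected : ∀ {t t′} → S′ t ≡ true → S′ t′ ≡ true → WalkIn T S′ t t′
    S′-connected St St′ with new-or-old St | new-or-old St′
    ... | inj₁ refl | inj₁ refl = here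
    ... | inj₁ refl | inj₂ St′  = step y′y (S⊆S′ y Sy) (weaken T S⊆S′ (S-connected Sy St′))
    ... | inj₂ St   | inj₁ refl = snoc T (weaken T S⊆S′ (S-connected St Sy)) yy′ y′∈S′
    ... | inj₂ St   | inj₂ St′  = weaken T S⊆S′ (S-connected St St′)

    f′-into : ∀ {t} → S′ t ≡ true → F′ (f′ t) ≡ true
    f′-into St with new-or-old St
    ... | inj₁ refl = subst (λ x → F′ x ≡ true) (sym f′-new) (updateAt-updates z F)
    ... | inj₂ St   = subst (λ x → F′ x ≡ true) (sym (f′-old St)) (⊆-insert F z _ (f-into St))

    f′-injective : ∀ {t t′} → S′ t ≡ true → S′ t′ ≡ true → f′ t ≡ f′ t′ → t ≡ t′
    f′-injective St St′ same with new-or-old St | new-or-old St′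
    ... | inj₁ refl | inj₁ refl = refl
    ... | inj₁ refl | inj₂ St′  = ⊥-elim (z-fresh St′ (trans (sym (f′-old St′)) (trans (sym same) f′-new)))
    ... | inj₂ St   | inj₁ refl = ⊥-elim (z-fresh St (trans (sym (f′-old St)) (trans same f′-new)))
    ... | inj₂ St   | inj₂ St′  = f-injective St St′ (trans (sym (f′-old St)) (trans same (f′-old St′)))

    f′-homomorphic : ∀ {t t′} → S′ t ≡ true → S′ t′ ≡ true → adj T t t′ ≡ true → adj G (f′ t) (f′ t′) ≡ true
    f′-homomorphic {t} {t′} St St′ tt′ with new-or-old St | new-or-old St′
    ... | inj₁ refl | inj₁ refl = ⊥-elim (true≢false tt′ (irrefl T t))
    ... | inj₁ refl | inj₂ St′ rewrite only-neighbour St′ (trans (adj-sym T t′ t) tt′) | f′-new | f′-old Sy =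
      trans (adj-sym G z (f y)) fy-z
    ... | inj₂ St   | inj₁ refl rewrite only-neighbour St tt′ | f′-new | f′-old Sy = fy-z
    ... | inj₂ St   | inj₂ St′ rewrite f′-old St | f′-old St′ = f-homomorphic St St′ tt′

    degree-old : ∀ t → degreeIn T S′ t ≡ degreeIn T S t + χ (adj T t y′)
    degree-old t = degreeIn-insert T t Sy′

    degree-new : degreeIn T S′ y′ ≡ 1
    degree-new = begin
      degreeIn T S′ y′                   ≡⟨ degree-old y′ ⟩
      degreeIn T S y′ + χ (adj T y′ y′)  ≡⟨ cong (λ b → degreeIn T S y′ + χ b) (irrefl T y′) ⟩
      degreeIn T S y′ + 0                ≡⟨ +-identityʳ _ ⟩
      degreeIn T S y′                    ≡⟨ count-cong just-y ⟩
      count (insert ∅ y)                 ≡⟨ count-insert (∅ {m}) refl ⟩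
      suc (count (∅ {m}))                ≡⟨ cong suc (count-∅ {m}) ⟩
      1                                  ∎
      where
      open ≡-Reasoning
      just-y : ∀ u → S u ∧ adj T y′ u ≡ insert ∅ y u
      just-y u with u ≟ᶠ y
      ... | yes refl rewrite Sy | y′y = sym (updateAt-updates u ∅)
      ... | no  u≢y  with S u ∧ adj T y′ u in Su∧y′u
      ...   | true  = ⊥-elim (u≢y (only-neighbour (proj₁ (∧-true Su∧y′u))
                                                  (trans (adj-sym T u y′) (proj₂ (∧-true {S u} Su∧y′u)))))
      ...   | false = sym (updateAt-minimal u y ∅ u≢y)

    c′-z : c′ z ≡ pred k
    c′-z = trans (updateAt-updates z (updateAt c (f y) pred))
                 (cong pred (trans (updateAt-minimal z (f y) c (z-fresh Sy ∘ sym)) (c-unused Fz)))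

    c′-fy : c′ (f y) ≡ pred (c (f y))
    c′-fy = trans (updateAt-minimal (f y) z (updateAt c (f y) pred) (z-fresh Sy)) (updateAt-updates (f y) c)

    c′-other : ∀ {x} → x ≢ z → x ≢ f y → c′ x ≡ c x
    c′-other {x} x≢z x≢fy = trans (updateAt-minimal x z _ x≢z) (updateAt-minimal x (f y) c x≢fy)

    1≤c-fy : 1 ≤ c (f y)
    1≤c-fy = spare-capacity e Sy Sy′ yy′

    c′-remaining-new : c′ (f′ y′) + degreeIn T S′ y′ ≡ k
    c′-remaining-new = begin
      c′ (f′ y′) + degreeIn T S′ y′      ≡⟨ cong₂ _+_ (trans (cong c′ f′-new) c′-z) degree-new ⟩
      pred k + 1                         ≡⟨ +-comm (pred k) 1 ⟩
      suc (pred k)                       ≡⟨ suc-pred k {{>-nonZero (≤-trans 1≤c-fy (c≤k (f y)))}} ⟩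
      k                                  ∎
      where open ≡-Reasoning

    c′-remaining-parent : c′ (f′ y) + degreeIn T S′ y ≡ k
    c′-remaining-parent = begin
      c′ (f′ y) + degreeIn T S′ y      ≡⟨ cong₂ _+_ (trans (cong c′ (f′-old Sy)) c′-fy) (degree-old y) ⟩
      pred (c (f y)) + (d + χ (adj T y y′)) ≡⟨ cong (λ b → pred (c (f y)) + (d + χ b)) yy′ ⟩
      pred (c (f y)) + (d + 1)         ≡⟨ shift (pred (c (f y))) d ⟩
      suc (pred (c (f y))) + d         ≡⟨ cong (_+ d) (suc-pred (c (f y)) {{>-nonZero 1≤c-fy}}) ⟩
      c (f y) + d                      ≡⟨ c-remaining Sy ⟩
      k                                ∎
      where
      open ≡-Reasoning
      d : ℕ
      d = degreeIn T S y
      shift : ∀ a d → a + (d + 1) ≡ suc a + d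
      shift = solve-∀

    c′-remaining-other : ∀ {t} → S t ≡ true → t ≢ y → c′ (f′ t) + degreeIn T S′ t ≡ k
    c′-remaining-other {t} St t≢y = begin
      c′ (f′ t) + degreeIn T S′ t      ≡⟨ cong₂ _+_ (trans (cong c′ (f′-old St)) c′-ft) (degree-old t) ⟩
      c (f t) + (d + χ (adj T t y′))   ≡⟨ cong (λ b → c (f t) + (d + χ b)) not-adjacent ⟩
      c (f t) + (d + 0)                ≡⟨ cong (c (f t) +_) (+-identityʳ d) ⟩
      c (f t) + d                      ≡⟨ c-remaining St ⟩
      k                                ∎
      where
      open ≡-Reasoning
      d : ℕ
      d = degreeIn T S t
      c′-ft : c′ (f t) ≡ c (f t)
      c′-ft = c′-other (z-fresh St) (t≢y ∘ f-injective St Sy)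
      not-adjacent : adj T t y′ ≡ false
      not-adjacent with adj T t y′ in ty′
      ... | true  = ⊥-elim (t≢y (only-neighbour St ty′))
      ... | false = refl

    c′-remaining : ∀ {t} → S′ t ≡ true → c′ (f′ t) + degreeIn T S′ t ≡ k
    c′-remaining {t} St with new-or-old St
    ... | inj₁ refl = c′-remaining-new
    ... | inj₂ St with t ≟ᶠ y
    ...   | yes refl = c′-remaining-parent
    ...   | no  t≢y  = c′-remaining-other St t≢y

    c′≤k : ∀ x → c′ x ≤ k
    c′≤k x = ≤-trans (updateAt-pred-≤ _ z x) (≤-trans (updateAt-pred-≤ c (f y) x) (c≤k x))

    c′-unused : ∀ {x} → F′ x ≡ false → c′ x ≡ k
    c′-unused {x} F′x = trans (c′-other x≢z x≢fy) (c-unused Fx)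
      where
      Fx : F x ≡ false
      Fx with F x in Fx
      ... | true  = ⊥-elim (true≢false (⊆-insert F z x Fx) F′x)
      ... | false = refl
      x≢z : x ≢ z
      x≢z refl = true≢false (updateAt-updates x F) F′x
      x≢fy : x ≢ f y
      x≢fy refl = true≢false (f-into Sy) Fx

    F′⊆H : F′ ⊆ H
    F′⊆H x x∈ = [ (λ { refl → Hz }) , F⊆H x ]′ (∈-insert⁻ F z x x∈)

    grown : PartialEmbedding
    grown = record
      { S = S′ ; F = F′ ; f = f′ ; c = c′
      ; t₀∈S          = S⊆S′ t₀ t₀∈S
      ; |S|≡|F|       = trans (count-insert S Sy′) (trans (cong suc |S|≡|F|) (sym (count-insert F Fz)))
      ; S-connected   = S′-connected
      ; f-into        = f′-into
      ; f-injective   = f′-injective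
      ; f-homomorphic = f′-homomorphic
      ; c-remaining   = c′-remaining
      ; c≤k           = c′≤k
      ; c-unused      = c′-unused
      ; F⊆H           = F′⊆H
      ; good          = good′
      }

  grow : ∀ (e : PartialEmbedding) → count (E.S e) < m →
    Σ[ e′ ∈ PartialEmbedding ] count (E.S e′) ≡ suc (count (E.S e))
  grow e |S|<m with count<⇒false (E.S e) |S|<m
  ... | y₀ , Sy₀ with crossing-edge T (E.S e) (T-connected t₀ y₀) (E.t₀∈S e) Sy₀
  ... | y , y′ , Sy , Sy′ , yy′ =
    let z , Hz , Fz , fy-z , good′ = extend G H k m expanding (E.good e) (E.F⊆H e) |F|<m (E.c≤k e)
                                            unused-positive (E.f-into e Sy) (spare-capacity e Sy Sy′ yy′)
    in Grow.grown e Sy Sy′ yy′ Hz Fz fy-z good′ , count-insert (E.S e) Sy′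
    where
    |F|<m : count (E.F e) < m
    |F|<m = subst (_< m) (E.|S|≡|F| e) |S|<m
    unused-positive : ∀ x → E.F e x ≡ false → 1 ≤ E.c e x
    unused-positive x Fx = subst (1 ≤_) (sym (E.c-unused e Fx)) (≤-trans (spare-capacity e Sy Sy′ yy′) (E.c≤k e _))

  embedding-of-size : ∀ {v₀} → H v₀ ≡ true → ∀ j → suc j ≤ m →
    Σ[ e ∈ PartialEmbedding ] count (E.S e) ≡ suc j
  embedding-of-size Hv₀ zero    _      = singleton-embedding Hv₀ , count-singleton t₀
  embedding-of-size Hv₀ (suc j) j+2≤m =
    let e , |S|≡j+1 = embedding-of-size Hv₀ j (<⇒≤ j+2≤m)
        e′ , |S′|≡  = grow e (subst (_< m) (sym |S|≡j+1) j+2≤m)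
    in e′ , trans |S′|≡ (cong suc |S|≡j+1)

  embedding : ∀ {v₀} → H v₀ ≡ true → T ⊆G G
  embedding Hv₀ =
    E.f e , E.f-injective e (everything _) (everything _) , λ t t′ → E.f-homomorphic e (everything t) (everything t′)
    where
    m≡ : suc (pred m) ≡ m
    m≡ = suc-pred m {{nonZeroIndex t₀}}
    full : Σ[ e ∈ PartialEmbedding ] count (E.S e) ≡ suc (pred m)
    full = embedding-of-size Hv₀ (pred m) (≤-reflexive m≡)
    e : PartialEmbedding
    e = proj₁ full
    everything : ∀ t → E.S e t ≡ true
    everything = count-full⇒true (E.S e) (trans (proj₂ full) m≡)

embed-bounded-degree-tree : ∀ {n m} p q k .{{_ : NonZero p}} (G : Graph n) → 0 < n →
  2 * p * (2 + k) * n ≤ q * edges G →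
  (∀ R → count R ≤ (2 + k) * (2 * m) → edgesIn G R * q ≤ p * count R) →
  (T : Graph m) → IsTree T → MaxDegreeAtMost T k → T ⊆G G
embed-bounded-degree-tree {n} {m} p q k G 0<n dense sparse T (m≢0 , T-connected , T-acyclic) Δ≤k
  with min-degree-subgraph G (2 * p * (2 + k)) q 0<n dense
... | H , (v₀ , Hv₀) , min-degree =
  embedding G H k expanding T (fromℕ< (>-nonZero⁻¹ m {{m≢0}})) T-connected T-acyclic Δ≤k Hv₀
  where
  expanding : Expanding G H k m
  expanding X X⊆H small = +-cancelˡ-≤ (count X) (suc k * count X) (count (Γ G H X))
    (≤-trans (sparse⇒expansion G p q (2 + k) (2 * m) min-degree sparse X X⊆H small) (count-∪ X (Γ G H X)))

toℚᵘ-/ : ∀ a b → toℚᵘ (ℤ.+ a ℚ./ suc b) ℚᵘ.≃ mkℚᵘ (ℤ.+ a) b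
toℚᵘ-/ a b = ℚ.toℚᵘ-fromℚᵘ (mkℚᵘ (ℤ.+ a) b)

/-·-/ : ∀ a b c d → (ℤ.+ a ℚ./ suc b) · (ℤ.+ c ℚ./ suc d) ≡ ℤ.+ (a * c) ℚ./ (suc b * suc d)
/-·-/ a b c d = ℚ.toℚᵘ-injective (begin
  toℚᵘ (a/b · c/d)                         ≈⟨ ℚ.toℚᵘ-homo-* a/b c/d ⟩
  toℚᵘ a/b ℚᵘ.* toℚᵘ c/d                   ≈⟨ ℚᵘ.*-cong (toℚᵘ-/ a b) (toℚᵘ-/ c d) ⟩
  mkℚᵘ (ℤ.+ a) b ℚᵘ.* mkℚᵘ (ℤ.+ c) d       ≡⟨ cong (λ i → i ℚᵘ./ (suc b * suc d)) (ℤ.pos-* a c) ⟨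
  ℤ.+ (a * c) ℚᵘ./ (suc b * suc d)         ≈⟨ toℚᵘ-/ (a * c) _ ⟨
  toℚᵘ (ℤ.+ (a * c) ℚ./ (suc b * suc d))   ∎)
  where
  open ℚᵘ.≃-Reasoning
  a/b c/d : ℚ
  a/b = ℤ.+ a ℚ./ suc b
  c/d = ℤ.+ c ℚ./ suc d

/-≤-/⇒ : ∀ a b c d .{{_ : NonZero b}} .{{_ : NonZero d}} →
  ℤ.+ a ℚ./ b ℚ.≤ ℤ.+ c ℚ./ d → a * d ≤ c * b
/-≤-/⇒ a (suc b) c (suc d) a/b≤c/d
  with ℚᵘ.≤-respʳ-≃ (toℚᵘ-/ c d) (ℚᵘ.≤-respˡ-≃ (toℚᵘ-/ a b) (ℚ.toℚᵘ-mono-≤ a/b≤c/d))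
... | ℚᵘ.*≤* ad≤cb = ℤ.drop‿+≤+ (subst₂ ℤ._≤_ (sym (ℤ.pos-* a (suc d))) (sym (ℤ.pos-* c (suc b))) ad≤cb)

⇒/-≤-/ : ∀ a b c d .{{_ : NonZero b}} .{{_ : NonZero d}} →
  a * d ≤ c * b → ℤ.+ a ℚ./ b ℚ.≤ ℤ.+ c ℚ./ d
⇒/-≤-/ a (suc b) c (suc d) ad≤cb = ℚ.toℚᵘ-cancel-≤
  (ℚᵘ.≤-respˡ-≃ (ℚᵘ.≃-sym (toℚᵘ-/ a b)) (ℚᵘ.≤-respʳ-≃ (ℚᵘ.≃-sym (toℚᵘ-/ c d))
    (ℚᵘ.*≤* (subst₂ ℤ._≤_ (ℤ.pos-* a (suc d)) (ℤ.pos-* c (suc b)) (ℤ.+≤+ ad≤cb)))))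

lemma2p9 : (ρ r : ℚ) → 0ℚ ℚ.< ρ → 0ℚ ℚ.< r → (k : ℕ) → NonZero k →
    (n : ℕ) .{{_ : NonZero n}} (G : Graph n) →
    Sparse ρ r G →
    ⟦ 4 ⟧ · ρ · ⟦ k + 2 ⟧ ℚ.≤ averageDegree G →
    (m : ℕ) (T : Graph m) → IsTree T → MaxDegreeAtMost T k →
    ⟦ m ⟧ ℚ.≤ r · (ℤ.+ 1 ℚ./ (2 * (2 + k))) →
    T ⊆G G
lemma2p9 (mkℚ ℤ.+0 _ _)          _ (ℚ.*<* (ℤ.+<+ ())) _ _ _ _ _ _ _ _ _ _ _ _
lemma2p9 (mkℚ ℤ.-[1+ _ ] _ _)    _ (ℚ.*<* ())         _ _ _ _ _ _ _ _ _ _ _ _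
lemma2p9 _ _ _ _ _ _ zero {{()}} _ _ _ _ _ _ _ _
lemma2p9 ρ@(mkℚ ℤ.+[1+ p′ ] q′ p⊥q) r _ _ k _ (suc n′) G sparse dense m T tree Δ≤k small =
  embed-bounded-degree-tree p q k G (s≤s z≤n) dense-ℕ sparse-ℕ T tree Δ≤k
  where
  p q K : ℕ
  p = suc p′
  q = suc q′
  K = 2 * (2 + k)

  ρ≡p/q : ρ ≡ ℤ.+ p ℚ./ q
  ρ≡p/q = sym (ℚ.normalize-coprime p⊥q)

  small-sets : ∀ s → s ≤ (2 + k) * (2 * m) → ⟦ s ⟧ ℚ.≤ r
  small-sets s s≤ = ℚ.*-cancelʳ-≤-pos u {{ℚ.normalize-pos 1 K}} (begin
    ⟦ s ⟧ · u                ≡⟨ /-·-/ s 0 1 _ ⟩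
    ℤ.+ (s * 1) ℚ./ (1 * K)  ≤⟨ ⇒/-≤-/ (s * 1) (1 * K) m 1 (subst₂ _≤_ (s≡ s) (K-comm k m) s≤) ⟩
    ⟦ m ⟧                    ≤⟨ small ⟩
    r · u                    ∎)
    where
    open ℚ.≤-Reasoning
    u : ℚ
    u = ℤ.+ 1 ℚ./ K
    s≡ : ∀ s → s ≡ s * 1 * 1
    s≡ = solve-∀
    K-comm : ∀ k m → (2 + k) * (2 * m) ≡ m * (1 * (2 * (2 + k)))
    K-comm = solve-∀

  sparse-ℕ : ∀ R → count R ≤ (2 + k) * (2 * m) → edgesIn G R * q ≤ p * count R
  sparse-ℕ R R-small = subst₂ _≤_ (cong (e *_) (*-identityʳ q)) (*-identityʳ (p * s))
    (/-≤-/⇒ e 1 (p * s) (q * 1) (begin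
      ⟦ e ⟧                      ≤⟨ sparse R (small-sets s R-small) ⟩
      ρ · ⟦ s ⟧                  ≡⟨ cong (_· ⟦ s ⟧) ρ≡p/q ⟩
      (ℤ.+ p ℚ./ q) · ⟦ s ⟧      ≡⟨ /-·-/ p q′ s 0 ⟩
      ℤ.+ (p * s) ℚ./ (q * 1)    ∎))
    where
    open ℚ.≤-Reasoning
    e s : ℕ
    e = edgesIn G R
    s = count R

  dense-ℕ : 2 * p * (2 + k) * suc n′ ≤ q * edges G
  dense-ℕ = *-cancelˡ-≤ 2 (subst₂ _≤_ (scale-left p k (suc n′)) (scale-right (edges G) q)
    (/-≤-/⇒ (4 * p * (k + 2)) (1 * q * 1) (2 * edges G) (suc n′) (begin
      ℤ.+ (4 * p * (k + 2)) ℚ./ (1 * q * 1)  ≡⟨ /-·-/ (4 * p) _ (k + 2) 0 ⟨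
      ℤ.+ (4 * p) ℚ./ (1 * q) · ⟦ k + 2 ⟧    ≡⟨ cong (_· ⟦ k + 2 ⟧) (/-·-/ 4 0 p q′) ⟨
      ⟦ 4 ⟧ · (ℤ.+ p ℚ./ q) · ⟦ k + 2 ⟧      ≡⟨ cong (λ x → ⟦ 4 ⟧ · x · ⟦ k + 2 ⟧) ρ≡p/q ⟨
      ⟦ 4 ⟧ · ρ · ⟦ k + 2 ⟧                  ≤⟨ dense ⟩
      averageDegree G                        ∎)))
    where
    open ℚ.≤-Reasoning
    scale-left : ∀ p k n → 4 * p * (k + 2) * n ≡ 2 * (2 * p * (2 + k) * n)
    scale-left = solve-∀
    scale-right : ∀ e q → 2 * e * (1 * q * 1) ≡ 2 * (q * e)
    scale-right = solve-∀
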